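{- Let $n,r\ge1$, $0\le m\le n$, and let $J\subset\{1,\ldots,n\}$ with $\#J=m$. Let $G$ be a random bipartite $r$-regular multigraph distributed according to $\nu(n,r)$ and let $\phi(G,J)$ be the number of $m$-matchings of $G$ covering the white vertex set $J$. Then $$E_{\nu(n,r)}\big(\phi(G,J)\big)=\frac{\binom{n}{m}r^{2m}m!(rn-m)!}{(rn)!}.$$
   Context: Bipartite multigraphs have black vertices $\{1,\ldots,n\}$ and white vertices $\{1,\ldots,n\}$; an $m$-matching is a set of $m$ edges with no common endpoints, and $\phi(G,J)=\sum_{I\subset\{1,\ldots,n\},\#I=m}\mathrm{perm}\,A(G)[I|J]$ where $A(G)$ is the $n\times n$ matrix whose $(i,j)$ entry counts edges between black $i$ and white $j$. The measure $\nu(n,r)$ is the standard (configuration) model on $r$-regular bipartite multigraphs: each vertex carries $r$ half-edges and a uniformly random bijection between the $rn$ black half-edges and the $rn$ white half-edges determines the edges; it is invariant under permutations of the black and of the white vertices. -}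

module Defs where

open import Data.Nat using (ℕ; zero; suc; _+_; _*_; _∸_; _^_; _!)
open import Data.Nat.Properties using (_!≢0)
open import Data.Nat.Combinatorics using (_C_)
open import Data.Integer using (+_)
open import Data.Rational using (ℚ; _/_)
open import Data.List using (List; []; _∷_; map; concatMap; zipWith; zip; filter; length; cartesianProduct; _++_)
open import Data.Fin using (Fin)
open import Data.Fin.Properties using (_≟_)
open import Data.Fin.Subset using (Subset; ∣_∣; _∈_; inside; outside)
open import Data.Fin.Subset.Properties using (_∈?_)
open import Data.Vec using ([]; _∷_)
open import Data.Product using (_×_; _,_; proj₁; proj₂)
open import Data.List.Base using (allFin)
open import Data.Nat.ListAction using (sum; product)
open import Relation.Nullary using (Dec)
open import Relation.Nullary.Decidable using (_×-dec_)
import Data.Nat.Properties as ℕP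

private variable A : Set

insertAll : A → List A → List (List A)
insertAll x [] = (x ∷ []) ∷ []
insertAll x (y ∷ ys) = (x ∷ y ∷ ys) ∷ map (y ∷_) (insertAll x ys)

-- all permutations (rearrangements) of a list; for a list of distinct
-- elements these are exactly the distinct bijective rearrangements
perms : List A → List (List A)
perms [] = [] ∷ []
perms (x ∷ xs) = concatMap (insertAll x) (perms xs)

Matrix : ℕ → Set
Matrix n = Fin n → Fin n → ℕ

elems : ∀ {n} → Subset n → List (Fin n)
elems {n} I = filter (_∈? I) (allFin n)

allSubsets : ∀ n → List (Subset n)
allSubsets zero = [] ∷ []
allSubsets (suc n) = map (inside ∷_) (allSubsets n) ++ map (outside ∷_) (allSubsets n)

subsetsOfSize : ∀ n → ℕ → List (Subset n)
subsetsOfSize n m = filter (λ I → ∣ I ∣ ℕP.≟ m) (allSubsets n)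

permSub : ∀ {n} → Matrix n → Subset n → Subset n → ℕ
permSub A I J =
  sum (map (λ cols → product (zipWith A (elems I) cols)) (perms (elems J)))

φ : ∀ {n} → Matrix n → ℕ → Subset n → ℕ
φ {n} A m J = sum (map (λ I → permSub A I J) (subsetsOfSize n m))

-- half-edges: pairs (vertex, slot); there are n*r of each colour
HalfEdge : ℕ → ℕ → Set
HalfEdge n r = Fin n × Fin r

halfEdges : ∀ n r → List (HalfEdge n r)
halfEdges n r = cartesianProduct (allFin n) (allFin r)

-- a configuration: a bijection black half-edges → white half-edges,
-- encoded as the rearrangement σ of the white half-edges, the k-th black
-- half-edge (in the order of halfEdges) being paired with the k-th entry of σ
configurations : ∀ n r → List (List (HalfEdge n r))
configurations n r = perms (halfEdges n r)

adjacency : ∀ {n r} → List (HalfEdge n r) → Matrix n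
adjacency {n} {r} σ i j =
  length (filter (λ p → (proj₁ (proj₁ p) ≟ i) ×-dec (proj₁ (proj₂ p) ≟ j))
                 (zip (halfEdges n r) σ))

E-ν : (n r : ℕ) → (Matrix n → ℕ) → ℚ
E-ν n r f = (+ sum (map (λ σ → f (adjacency σ)) (configurations n r)) / ((r * n) !))
              {{(r * n) !≢0}}

rhs : (n r m : ℕ) → ℚ
rhs n r m = (+ ((n C m) * r ^ (2 * m) * m ! * (r * n ∸ m) !) / ((r * n) !))
              {{(r * n) !≢0}}

module Submission where

-- A configuration pairs the list a of black half-edge labels (vertex i repeated r times)
-- position by position with a rearrangement σ of the white labels, and A(G)(i,j) is the
-- number of positions carrying (i,j).  Exchanging sums, the numerator of E φ(G,J) is a sum
-- over m-sets I and bijections I → J of Σ_σ Π_t A(i_t,j_t).  For a matching whose black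
-- ends are distinct and whose white ends are distinct this inner sum is
-- Π_t deg(i_t) deg(j_t) · (N − m)!: expand the first factor over the positions k with
-- a_k = i_1 and enumerate σ by first choosing its entry at k; forcing that entry to be j_1
-- deletes one copy of i_1 from a and one copy of j_1 from σ without changing the counts of
-- the other pairs, so induction on the matching applies.  With all degrees r and N = rn the
-- numerator is C(n,m) · m! · r^{2m} (rn − m)!.

open import Defs
open import Data.Nat using (ℕ; _≤_; _≥_)
open import Data.Fin.Subset using (Subset; ∣_∣)
open import Relation.Binary.PropositionalEquality using (_≡_)

open import Data.Bool using (Bool; true; false; if_then_else_; _∧_)
open import Data.Fin as Fin using (Fin)
open import Data.Fin.Properties using (_≟_)
open import Data.Fin.Subset using (inside; outside)
open import Data.Fin.Subset.Properties using (_∈?_)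
import Data.Integer as ℤ
open import Data.List
  using (List; []; _∷_; map; concatMap; _++_; length; zip; zipWith; upTo; filter; cartesianProduct; allFin)
open import Data.List.Properties
  using (map-++; map-∘; map-cong; map-cong-local; length-map; length-++; length-tabulate; concatMap-map;
         concatMap-cong; map-concatMap; map-upTo; map-tabulate; zip-map; zipWith-cong)
open import Data.List.Relation.Binary.Permutation.Propositional
  using (_↭_; ↭-refl; ↭-prep; ↭-swap; ↭-trans; ↭-sym; ↭⇒↭ₛ)
open import Data.List.Relation.Binary.Permutation.Propositional.Properties
  using (↭-length) renaming (map⁺ to ↭-map⁺)
import Data.List.Relation.Binary.Permutation.Setoid.Properties as Setoid-↭
open import Data.List.Relation.Unary.All as All using (All; []; _∷_; universal-U)
open import Data.List.Relation.Unary.All.Properties using (concat⁺; all-filter) renaming (map⁺ to All-map⁺)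
open import Data.List.Relation.Unary.Unique.Propositional using (Unique; _∷_)
import Data.List.Relation.Unary.Unique.Propositional.Properties as Unique
open import Data.Nat using (zero; suc; _+_; _*_; _∸_; _^_; _!; _<_; z≤n; s≤s; s≤s⁻¹)
open import Data.Nat.Combinatorics using (_C_; nCk+nC[k+1]≡[n+1]C[k+1])
open import Data.Nat.ListAction using (sum; product)
open import Data.Nat.ListAction.Properties using (sum-++; sum-↭)
import Data.Nat.Properties as ℕ
open import Data.Nat.Properties
  using (+-identityʳ; *-identityˡ; *-identityʳ; *-zeroʳ; *-comm; *-assoc; *-distribˡ-+; *-distribʳ-+;
         ^-*-assoc; ≤-trans; ≤-reflexive; suc-injective; _!≢0)
open import Data.Nat.Tactic.RingSolver using (solve-∀)
open import Algebra.Properties.CommutativeSemigroup ℕ.+-commutativeSemigroup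
  using () renaming (interchange to +-interchange; x∙yz≈y∙xz to x+[y+z]≡y+[x+z])
open import Data.Product as Product using (_×_; _,_; proj₁)
open import Data.Rational using (_/_)
open import Data.Vec using ([]; _∷_)
open import Function using (_∘_; id)
open import Relation.Binary.Definitions using (DecidableEquality)
open import Relation.Binary.PropositionalEquality
  using (_≢_; refl; sym; trans; cong; cong₂; setoid; module ≡-Reasoning)
open import Relation.Nullary using (does; yes; no; contradiction)
open import Relation.Nullary.Decidable using (_×-dec_)
open import Relation.Unary using (Pred; Decidable)

private variable
  A B : Set

∑ : List A → (A → ℕ) → ℕ
∑ xs f = sum (map f xs)

-- The body of ∑[ x ← xs ] is a single application: ∑[ x ← xs ] f x * c means (∑[ x ← xs ] f x) * c.
syntax ∑ xs (λ x → e) = ∑[ x ← xs ] e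

∑-cong : ∀ (xs : List A) {f g : A → ℕ} → (∀ x → f x ≡ g x) → ∑ xs f ≡ ∑ xs g
∑-cong xs f≗g = cong sum (map-cong f≗g xs)

∑-cong-All : ∀ {xs : List A} {f g : A → ℕ} → All (λ x → f x ≡ g x) xs → ∑ xs f ≡ ∑ xs g
∑-cong-All = cong sum ∘ map-cong-local

∑-++ : ∀ (xs ys : List A) (f : A → ℕ) → ∑ (xs ++ ys) f ≡ ∑ xs f + ∑ ys f
∑-++ xs ys f = trans (cong sum (map-++ f xs ys)) (sum-++ (map f xs) (map f ys))

∑-map : ∀ (g : A → B) (xs : List A) (f : B → ℕ) → ∑ (map g xs) f ≡ ∑[ x ← xs ] f (g x)
∑-map g xs f = cong sum (sym (map-∘ xs))

∑-concatMap : ∀ (g : A → List B) (xs : List A) (f : B → ℕ) → ∑ (concatMap g xs) f ≡ ∑[ x ← xs ] ∑ (g x) f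
∑-concatMap g []       f = refl
∑-concatMap g (x ∷ xs) f = trans (∑-++ (g x) (concatMap g xs) f) (cong (∑ (g x) f +_) (∑-concatMap g xs f))

∑-↭ : ∀ {xs ys : List A} (f : A → ℕ) → xs ↭ ys → ∑ xs f ≡ ∑ ys f
∑-↭ f = sum-↭ ∘ ↭-map⁺ f

∑-distrib-+ : ∀ (xs : List A) (f g : A → ℕ) → ∑[ x ← xs ] (f x + g x) ≡ ∑ xs f + ∑ xs g
∑-distrib-+ []       f g = refl
∑-distrib-+ (x ∷ xs) f g = trans (cong (f x + g x +_) (∑-distrib-+ xs f g)) (+-interchange (f x) (g x) _ _)

*-distribˡ-∑ : ∀ c (xs : List A) (f : A → ℕ) → c * ∑ xs f ≡ ∑[ x ← xs ] (c * f x)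
*-distribˡ-∑ c []       f = *-zeroʳ c
*-distribˡ-∑ c (x ∷ xs) f = trans (*-distribˡ-+ c (f x) (∑ xs f)) (cong (c * f x +_) (*-distribˡ-∑ c xs f))

*-distribʳ-∑ : ∀ c (xs : List A) (f : A → ℕ) → ∑ xs f * c ≡ ∑[ x ← xs ] (f x * c)
*-distribʳ-∑ c []       f = refl
*-distribʳ-∑ c (x ∷ xs) f = trans (*-distribʳ-+ c (f x) (∑ xs f)) (cong (f x * c +_) (*-distribʳ-∑ c xs f))

∑-const : ∀ (xs : List A) c → ∑[ _ ← xs ] c ≡ length xs * c
∑-const []       c = refl
∑-const (x ∷ xs) c = cong (c +_) (∑-const xs c)

∑-zero : ∀ (xs : List A) → ∑[ _ ← xs ] 0 ≡ 0
∑-zero xs = trans (∑-const xs 0) (*-zeroʳ (length xs))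

∑-comm : ∀ (xs : List A) (ys : List B) (f : A → B → ℕ) →
  ∑[ x ← xs ] ∑[ y ← ys ] f x y ≡ ∑[ y ← ys ] ∑[ x ← xs ] f x y
∑-comm []       ys f = sym (∑-zero ys)
∑-comm (x ∷ xs) ys f =
  trans (cong (∑ ys (f x) +_) (∑-comm xs ys f)) (sym (∑-distrib-+ ys (f x) (λ y → ∑[ x′ ← xs ] f x′ y)))

∑-upTo-suc : ∀ n (f : ℕ → ℕ) → ∑ (upTo (suc n)) f ≡ f 0 + ∑[ k ← upTo n ] f (suc k)
∑-upTo-suc n f = cong (f 0 +_) (trans (cong (λ ks → ∑ ks f) (sym (map-upTo suc n))) (∑-map suc (upTo n) f))

∑-allFin-suc : ∀ n (f : Fin (suc n) → ℕ) → ∑ (allFin (suc n)) f ≡ f Fin.zero + ∑[ x ← allFin n ] f (Fin.suc x)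
∑-allFin-suc n f =
  cong (f Fin.zero +_) (trans (cong (λ xs → ∑ xs f) (sym (map-tabulate id Fin.suc))) (∑-map Fin.suc (allFin n) f))

∑-cartesianProduct : ∀ (xs : List A) (ys : List B) (f : A × B → ℕ) →
  ∑ (cartesianProduct xs ys) f ≡ ∑[ x ← xs ] ∑[ y ← ys ] f (x , y)
∑-cartesianProduct []       ys f = refl
∑-cartesianProduct (x ∷ xs) ys f =
  trans (∑-++ (map (x ,_) ys) (cartesianProduct xs ys) f) (cong₂ _+_ (∑-map (x ,_) ys f) (∑-cartesianProduct xs ys f))

𝟙 : Bool → ℕ
𝟙 b = if b then 1 else 0

𝟙-∧ : ∀ b c → 𝟙 (b ∧ c) ≡ 𝟙 b * 𝟙 c
𝟙-∧ true  c = sym (+-identityʳ (𝟙 c))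
𝟙-∧ false c = refl

length-filter-∑ : ∀ {ℓ} {P : Pred A ℓ} (P? : Decidable P) xs → length (filter P? xs) ≡ ∑[ x ← xs ] 𝟙 (does (P? x))
length-filter-∑ P? []       = refl
length-filter-∑ P? (x ∷ xs) with does (P? x)
... | true  = cong suc (length-filter-∑ P? xs)
... | false = length-filter-∑ P? xs

length-concatMap : ∀ (g : A → List B) xs → length (concatMap g xs) ≡ ∑[ x ← xs ] length (g x)
length-concatMap g []       = refl
length-concatMap g (x ∷ xs) = trans (length-++ (g x)) (cong (length (g x) +_) (length-concatMap g xs))

length-cartesianProduct : ∀ (xs : List A) (ys : List B) → length (cartesianProduct xs ys) ≡ length xs * length ys
length-cartesianProduct []       ys = refl
length-cartesianProduct (x ∷ xs) ys =
  trans (length-++ (map (x ,_) ys)) (cong₂ _+_ (length-map (x ,_) ys) (length-cartesianProduct xs ys))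

*-congˡ-≢0 : ∀ c {m n} → (c ≢ 0 → m ≡ n) → c * m ≡ c * n
*-congˡ-≢0 zero    _  = refl
*-congˡ-≢0 (suc c) eq = cong (suc c *_) (eq λ ())

zipWith-cong-All : ∀ {C : Set} {P : A → Set} {Q : B → Set} {f g : A → B → C} {xs ys} →
  (∀ {x y} → P x → Q y → f x y ≡ g x y) → All P xs → All Q ys → zipWith f xs ys ≡ zipWith g xs ys
zipWith-cong-All eq []         _          = refl
zipWith-cong-All eq (_ ∷ _)    []         = refl
zipWith-cong-All eq (px ∷ pxs) (qy ∷ qys) = cong₂ _∷_ (eq px qy) (zipWith-cong-All eq pxs qys)

selections : List A → List (A × List A)
selections []       = []
selections (x ∷ xs) = (x , xs) ∷ map (λ (y , ys) → y , x ∷ ys) (selections xs)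

insertAt : ℕ → A → List A → List A
insertAt zero    y zs       = y ∷ zs
insertAt (suc k) y []       = y ∷ []
insertAt (suc k) y (z ∷ zs) = z ∷ insertAt k y zs

removeAt : ℕ → List A → List A
removeAt k       []       = []
removeAt zero    (x ∷ xs) = xs
removeAt (suc k) (x ∷ xs) = x ∷ removeAt k xs

insertAll-↭ : ∀ (x : A) ys → All (_↭ x ∷ ys) (insertAll x ys)
insertAll-↭ x []       = ↭-refl ∷ []
insertAll-↭ x (y ∷ ys) =
  ↭-refl ∷ All-map⁺ (All.map (λ p → ↭-trans (↭-prep y p) (↭-swap y x ↭-refl)) (insertAll-↭ x ys))

perms-↭ : ∀ (xs : List A) → All (_↭ xs) (perms xs)
perms-↭ []       = ↭-refl ∷ []
perms-↭ (x ∷ xs) = concat⁺ (All-map⁺ (All.map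
  (λ {τ} τ↭xs → All.map (λ σ↭x∷τ → ↭-trans σ↭x∷τ (↭-prep x τ↭xs)) (insertAll-↭ x τ)) (perms-↭ xs)))

selections-↭ : ∀ (xs : List A) → All (λ (y , ys) → y ∷ ys ↭ xs) (selections xs)
selections-↭ []       = []
selections-↭ (x ∷ xs) =
  ↭-refl ∷ All-map⁺ (All.map (λ p → ↭-trans (↭-swap _ x ↭-refl) (↭-prep x p)) (selections-↭ xs))

Unique-resp-↭ : ∀ {xs ys : List A} → xs ↭ ys → Unique xs → Unique ys
Unique-resp-↭ {A} p = Setoid-↭.Unique-resp-↭ (setoid A) (↭⇒↭ₛ p)

length-insertAll : ∀ (x : A) ys → length (insertAll x ys) ≡ suc (length ys)
length-insertAll x []       = refl
length-insertAll x (y ∷ ys) = cong suc (trans (length-map (y ∷_) (insertAll x ys)) (length-insertAll x ys))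

length-perms : ∀ (xs : List A) → length (perms xs) ≡ length xs !
length-perms []       = refl
length-perms (x ∷ xs) = begin
  length (concatMap (insertAll x) (perms xs))  ≡⟨ length-concatMap (insertAll x) (perms xs) ⟩
  ∑[ τ ← perms xs ] length (insertAll x τ)     ≡⟨ ∑-cong-All (All.map length-insertAll-↭ (perms-↭ xs)) ⟩
  ∑[ _ ← perms xs ] suc (length xs)            ≡⟨ ∑-const (perms xs) (suc (length xs)) ⟩
  length (perms xs) * suc (length xs)          ≡⟨ cong (_* suc (length xs)) (length-perms xs) ⟩
  length xs ! * suc (length xs)                ≡⟨ *-comm (length xs !) (suc (length xs)) ⟩
  suc (length xs) !                            ∎
  where
  open ≡-Reasoning
  length-insertAll-↭ : ∀ {τ} → τ ↭ xs → length (insertAll x τ) ≡ suc (length xs)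
  length-insertAll-↭ {τ} τ↭xs = trans (length-insertAll x τ) (cong suc (↭-length τ↭xs))

insertAll-map : ∀ (g : A → B) x ys → insertAll (g x) (map g ys) ≡ map (map g) (insertAll x ys)
insertAll-map g x []       = refl
insertAll-map g x (y ∷ ys) = cong (map g (x ∷ y ∷ ys) ∷_) (begin
  map (g y ∷_) (insertAll (g x) (map g ys))   ≡⟨ cong (map (g y ∷_)) (insertAll-map g x ys) ⟩
  map (g y ∷_) (map (map g) (insertAll x ys)) ≡⟨ map-∘ (insertAll x ys) ⟨
  map (map g ∘ (y ∷_)) (insertAll x ys)       ≡⟨ map-∘ (insertAll x ys) ⟩
  map (map g) (map (y ∷_) (insertAll x ys))   ∎)
  where open ≡-Reasoning

perms-map : ∀ (g : A → B) xs → perms (map g xs) ≡ map (map g) (perms xs)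
perms-map g []       = refl
perms-map g (x ∷ xs) = begin
  concatMap (insertAll (g x)) (perms (map g xs))        ≡⟨ cong (concatMap (insertAll (g x))) (perms-map g xs) ⟩
  concatMap (insertAll (g x)) (map (map g) (perms xs))  ≡⟨ concatMap-map (insertAll (g x)) (map g) (perms xs) ⟩
  concatMap (insertAll (g x) ∘ map g) (perms xs)        ≡⟨ concatMap-cong (insertAll-map g x) (perms xs) ⟩
  concatMap (map (map g) ∘ insertAll x) (perms xs)      ≡⟨ map-concatMap (map g) (insertAll x) (perms xs) ⟨
  map (map g) (concatMap (insertAll x) (perms xs))      ∎
  where open ≡-Reasoning

∑-selections-head : ∀ (xs : List A) (f : A → ℕ) → ∑[ (y , _) ← selections xs ] f y ≡ ∑ xs f
∑-selections-head []       f = refl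
∑-selections-head (x ∷ xs) f = cong (f x +_) (trans (∑-map _ (selections xs) (f ∘ proj₁)) (∑-selections-head xs f))

∑-selections-cons : ∀ (x : A) xs (f : A × List A → ℕ) →
  ∑ (selections (x ∷ xs)) f ≡ f (x , xs) + ∑[ (y , ys) ← selections xs ] f (y , x ∷ ys)
∑-selections-cons x xs f = cong (f (x , xs) +_) (∑-map _ (selections xs) f)

∑-selections-cong-∷ : ∀ (x x′ : A) xs (f g : A × List A → ℕ) →
  (∀ y z zs → f (y , z ∷ zs) ≡ g (y , z ∷ zs)) →
  ∑ (selections (x ∷ x′ ∷ xs)) f ≡ ∑ (selections (x ∷ x′ ∷ xs)) g
∑-selections-cong-∷ x x′ xs f g f≗g = begin
  ∑ (selections (x ∷ x′ ∷ xs)) f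
    ≡⟨ ∑-selections-cons x (x′ ∷ xs) f ⟩
  f (x , x′ ∷ xs) + ∑[ (y , ys) ← selections (x′ ∷ xs) ] f (y , x ∷ ys)
    ≡⟨ cong₂ _+_ (f≗g x x′ xs) (∑-cong (selections (x′ ∷ xs)) (λ (y , ys) → f≗g y x ys)) ⟩
  g (x , x′ ∷ xs) + ∑[ (y , ys) ← selections (x′ ∷ xs) ] g (y , x ∷ ys)
    ≡⟨ ∑-selections-cons x (x′ ∷ xs) g ⟨
  ∑ (selections (x ∷ x′ ∷ xs)) g ∎
  where open ≡-Reasoning

∑-selections-swap : ∀ {A : Set} (xs : List A) (h : A → A → List A → ℕ) →
  ∑[ (y , ys) ← selections xs ] ∑[ (z , zs) ← selections ys ] h y z zs ≡
  ∑[ (z , zs) ← selections xs ] ∑[ (y , ys) ← selections zs ] h y z ys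
∑-selections-swap     []       h = refl
∑-selections-swap {A} (x ∷ xs) h = begin
  ∑[ (y , ys) ← selections (x ∷ xs) ] ∑[ (z , zs) ← selections ys ] h y z zs
    ≡⟨ expand (λ y z zs → h y z zs) ⟩
  firstIsX + (secondIsX + ∑[ (y , ys) ← sel ] ∑[ (z , zs) ← selections ys ] h y z (x ∷ zs))
    ≡⟨ cong (λ s → firstIsX + (secondIsX + s)) (∑-selections-swap xs (λ y z zs → h y z (x ∷ zs))) ⟩
  firstIsX + (secondIsX + ∑[ (z , zs) ← sel ] ∑[ (y , ys) ← selections zs ] h y z (x ∷ ys))
    ≡⟨ x+[y+z]≡y+[x+z] firstIsX secondIsX _ ⟩
  secondIsX + (firstIsX + ∑[ (z , zs) ← sel ] ∑[ (y , ys) ← selections zs ] h y z (x ∷ ys))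
    ≡⟨ expand (λ z y ys → h y z ys) ⟨
  ∑[ (z , zs) ← selections (x ∷ xs) ] ∑[ (y , ys) ← selections zs ] h y z ys ∎
  where
  open ≡-Reasoning
  sel = selections xs
  firstIsX = ∑[ (z , zs) ← sel ] h x z zs
  secondIsX = ∑[ (y , ys) ← sel ] h y x ys
  expand : ∀ (g : A → A → List A → ℕ) →
    ∑[ (y , ys) ← selections (x ∷ xs) ] ∑[ (z , zs) ← selections ys ] g y z zs ≡
    ∑[ (z , zs) ← sel ] g x z zs
      + (∑[ (y , ys) ← sel ] g y x ys + ∑[ (y , ys) ← sel ] ∑[ (z , zs) ← selections ys ] g y z (x ∷ zs))
  expand g = trans (∑-selections-cons x xs _)
    (cong (∑[ (z , zs) ← sel ] g x z zs +_)
      (trans (∑-cong sel (λ (y , ys) → ∑-selections-cons x ys (λ (z , zs) → g y z zs)))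
             (∑-distrib-+ sel (λ (y , ys) → g y x ys) (λ (y , ys) → ∑[ (z , zs) ← selections ys ] g y z (x ∷ zs)))))

∑-perms-head : ∀ (x : A) xs (f : List A → ℕ) →
  ∑ (perms (x ∷ xs)) f ≡ ∑[ (y , ys) ← selections (x ∷ xs) ] ∑[ τ ← perms ys ] f (y ∷ τ)
∑-perms-head x []        f = sym (+-identityʳ _)
∑-perms-head x (x′ ∷ xs) f = begin
  ∑ (perms (x ∷ x′ ∷ xs)) f
    ≡⟨ ∑-concatMap (insertAll x) (perms (x′ ∷ xs)) f ⟩
  ∑[ τ ← perms (x′ ∷ xs) ] ∑ (insertAll x τ) f
    ≡⟨ ∑-perms-head x′ xs _ ⟩
  ∑[ (y , ys) ← sel ] ∑[ τ ← perms ys ] ∑ (insertAll x (y ∷ τ)) f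
    ≡⟨ ∑-cong sel (λ (y , ys) →
         trans (∑-cong (perms ys) (λ τ → cong (f (x ∷ y ∷ τ) +_) (∑-map (y ∷_) (insertAll x τ) f)))
               (∑-distrib-+ (perms ys) _ _)) ⟩
  ∑[ (y , ys) ← sel ] (∑[ τ ← perms ys ] f (x ∷ y ∷ τ) + ∑[ τ ← perms ys ] ∑[ σ ← insertAll x τ ] f (y ∷ σ))
    ≡⟨ ∑-distrib-+ sel (λ (y , ys) → ∑[ τ ← perms ys ] f (x ∷ y ∷ τ))
                       (λ (y , ys) → ∑[ τ ← perms ys ] ∑[ σ ← insertAll x τ ] f (y ∷ σ)) ⟩
  ∑[ (y , ys) ← sel ] ∑[ τ ← perms ys ] f (x ∷ y ∷ τ)
    + ∑[ (y , ys) ← sel ] ∑[ τ ← perms ys ] ∑[ σ ← insertAll x τ ] f (y ∷ σ)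
    ≡⟨ cong₂ _+_ (sym (∑-perms-head x′ xs (f ∘ (x ∷_))))
                 (∑-cong sel (λ (y , ys) → sym (∑-concatMap (insertAll x) (perms ys) (f ∘ (y ∷_))))) ⟩
  ∑[ τ ← perms (x′ ∷ xs) ] f (x ∷ τ) + ∑[ (y , ys) ← sel ] ∑[ σ ← perms (x ∷ ys) ] f (y ∷ σ)
    ≡⟨ ∑-selections-cons x (x′ ∷ xs) (λ (y , ys) → ∑[ τ ← perms ys ] f (y ∷ τ)) ⟨
  ∑[ (y , ys) ← selections (x ∷ x′ ∷ xs) ] ∑[ τ ← perms ys ] f (y ∷ τ) ∎
  where
  open ≡-Reasoning
  sel = selections (x′ ∷ xs)

∑-perms-insertAt : ∀ k (x : A) xs (f : List A → ℕ) →
  ∑ (perms (x ∷ xs)) f ≡ ∑[ (y , ys) ← selections (x ∷ xs) ] ∑[ τ ← perms ys ] f (insertAt k y τ)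
∑-perms-insertAt zero    x xs        f = ∑-perms-head x xs f
∑-perms-insertAt (suc k) x []        f = sym (+-identityʳ _)
∑-perms-insertAt (suc k) x (x′ ∷ xs) f = begin
  ∑ (perms (x ∷ x′ ∷ xs)) f
    ≡⟨ ∑-perms-head x (x′ ∷ xs) f ⟩
  ∑[ (y , ys) ← sel ] ∑[ τ ← perms ys ] f (y ∷ τ)
    ≡⟨ ∑-selections-cong-∷ x x′ xs (λ (y , ys) → ∑[ τ ← perms ys ] f (y ∷ τ))
         (λ (y , ys) → ∑[ (z , zs) ← selections ys ] ∑[ τ ← perms zs ] f (y ∷ insertAt k z τ))
         (λ y z zs → ∑-perms-insertAt k z zs (f ∘ (y ∷_))) ⟩
  ∑[ (y , ys) ← sel ] ∑[ (z , zs) ← selections ys ] ∑[ τ ← perms zs ] f (y ∷ insertAt k z τ)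
    ≡⟨ ∑-selections-swap (x ∷ x′ ∷ xs) (λ y z zs → ∑[ τ ← perms zs ] f (y ∷ insertAt k z τ)) ⟩
  ∑[ (z , zs) ← sel ] ∑[ (y , ys) ← selections zs ] ∑[ τ ← perms ys ] f (y ∷ insertAt k z τ)
    ≡⟨ ∑-selections-cong-∷ x x′ xs
         (λ (z , zs) → ∑[ (y , ys) ← selections zs ] ∑[ τ ← perms ys ] f (y ∷ insertAt k z τ))
         (λ (z , zs) → ∑[ τ ← perms zs ] f (insertAt (suc k) z τ))
         (λ z y ys → sym (∑-perms-head y ys (λ τ → f (insertAt (suc k) z τ)))) ⟩
  ∑[ (z , zs) ← sel ] ∑[ τ ← perms zs ] f (insertAt (suc k) z τ) ∎
  where
  open ≡-Reasoning
  sel = selections (x ∷ x′ ∷ xs)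

module Counting {A : Set} (_≟_ : DecidableEquality A) where

  δ : A → A → ℕ
  δ x y = 𝟙 (does (x ≟ y))

  multiplicity : A → List A → ℕ
  multiplicity i xs = ∑[ x ← xs ] δ x i

  pairCount : A → A → List A → List A → ℕ
  pairCount i j xs ys = ∑[ (x , y) ← zip xs ys ] (δ x i * δ y j)

  occursAt : A → List A → ℕ → ℕ
  occursAt i []       k       = 0
  occursAt i (x ∷ xs) zero    = δ x i
  occursAt i (x ∷ xs) (suc k) = occursAt i xs k

  -- Pairing xs with ys position by position gives a bipartite multigraph; matchingCount
  -- is js xs ys is the number of ways to pick, for each pair of zip is js, an edge joining it.
  matchingCount : List A → List A → List A → List A → ℕ
  matchingCount is js xs ys = product (zipWith (λ i j → pairCount i j xs ys) is js)

  degreeProduct : List A → List A → List A → List A → ℕ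
  degreeProduct is js xs ys = product (zipWith (λ i j → multiplicity i xs * multiplicity j ys) is js)

  δ-≢ : ∀ {x y} → x ≢ y → δ x y ≡ 0
  δ-≢ {x} {y} x≢y with x ≟ y
  ... | yes x≡y = contradiction x≡y x≢y
  ... | no  _   = refl

  δ≢0⇒≡ : ∀ {x y} → δ x y ≢ 0 → x ≡ y
  δ≢0⇒≡ {x} {y} δ≢0 with x ≟ y
  ... | yes x≡y = x≡y
  ... | no  _   = contradiction refl δ≢0

  multiplicity-↭-≢ : ∀ {i i′ xs′ xs} → i ∷ xs′ ↭ xs → i ≢ i′ →
    multiplicity i′ xs′ ≡ multiplicity i′ xs
  multiplicity-↭-≢ {i} {i′} {xs′} p i≢i′ =
    trans (cong (_+ multiplicity i′ xs′) (sym (δ-≢ i≢i′))) (∑-↭ (λ x → δ x i′) p)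

  multiplicity-positions : ∀ i xs → multiplicity i xs ≡ ∑[ k ← upTo (length xs) ] occursAt i xs k
  multiplicity-positions i []       = refl
  multiplicity-positions i (x ∷ xs) =
    trans (cong (δ x i +_) (multiplicity-positions i xs)) (sym (∑-upTo-suc (length xs) (occursAt i (x ∷ xs))))

  pairCount-positions : ∀ i j xs ys → pairCount i j xs ys ≡ ∑[ k ← upTo (length xs) ] (occursAt i xs k * occursAt j ys k)
  pairCount-positions i j []       ys       = refl
  pairCount-positions i j (x ∷ xs) []       =
    sym (trans (∑-cong (upTo (suc (length xs))) (λ k → *-zeroʳ (occursAt i (x ∷ xs) k))) (∑-zero (upTo (suc (length xs)))))
  pairCount-positions i j (x ∷ xs) (y ∷ ys) =
    trans (cong (δ x i * δ y j +_) (pairCount-positions i j xs ys))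
          (sym (∑-upTo-suc (length xs) (λ k → occursAt i (x ∷ xs) k * occursAt j (y ∷ ys) k)))

  ∑-pairCount-*-positions : ∀ i j xs (σs : List (List A)) (f : List A → ℕ) →
    ∑[ σ ← σs ] (pairCount i j xs σ * f σ)
      ≡ ∑[ k ← upTo (length xs) ] (occursAt i xs k * ∑[ σ ← σs ] (occursAt j σ k * f σ))
  ∑-pairCount-*-positions i j xs σs f = begin
    ∑[ σ ← σs ] (pairCount i j xs σ * f σ)
      ≡⟨ ∑-cong σs (λ σ → trans (cong (_* f σ) (pairCount-positions i j xs σ))
                                (*-distribʳ-∑ (f σ) ks (λ k → occursAt i xs k * occursAt j σ k))) ⟩
    ∑[ σ ← σs ] ∑[ k ← ks ] (occursAt i xs k * occursAt j σ k * f σ)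
      ≡⟨ ∑-comm σs ks (λ σ k → occursAt i xs k * occursAt j σ k * f σ) ⟩
    ∑[ k ← ks ] ∑[ σ ← σs ] (occursAt i xs k * occursAt j σ k * f σ)
      ≡⟨ ∑-cong ks (λ k → trans (∑-cong σs (λ σ → *-assoc (occursAt i xs k) (occursAt j σ k) (f σ)))
                                (sym (*-distribˡ-∑ (occursAt i xs k) σs (λ σ → occursAt j σ k * f σ)))) ⟩
    ∑[ k ← ks ] (occursAt i xs k * ∑[ σ ← σs ] (occursAt j σ k * f σ)) ∎
    where
    open ≡-Reasoning
    ks = upTo (length xs)

  occursAt≢0⇒< : ∀ {i} xs k → occursAt i xs k ≢ 0 → k < length xs
  occursAt≢0⇒< []       k       ≢0 = contradiction refl ≢0
  occursAt≢0⇒< (x ∷ xs) zero    ≢0 = s≤s z≤n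
  occursAt≢0⇒< (x ∷ xs) (suc k) ≢0 = s≤s (occursAt≢0⇒< xs k ≢0)

  occursAt≢0⇒δ : ∀ {i} xs k → occursAt i xs k ≢ 0 → ∀ i′ → occursAt i′ xs k ≡ δ i i′
  occursAt≢0⇒δ []       k       ≢0 i′ = contradiction refl ≢0
  occursAt≢0⇒δ (x ∷ xs) zero    ≢0 i′ rewrite δ≢0⇒≡ ≢0 = refl
  occursAt≢0⇒δ (x ∷ xs) (suc k) ≢0 i′ = occursAt≢0⇒δ xs k ≢0 i′

  occursAt≢0⇒↭ : ∀ {i} xs k → occursAt i xs k ≢ 0 → i ∷ removeAt k xs ↭ xs
  occursAt≢0⇒↭ []       k       ≢0 = contradiction refl ≢0
  occursAt≢0⇒↭ (x ∷ xs) zero    ≢0 rewrite δ≢0⇒≡ ≢0 = ↭-refl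
  occursAt≢0⇒↭ (x ∷ xs) (suc k) ≢0 = ↭-trans (↭-swap _ x ↭-refl) (↭-prep x (occursAt≢0⇒↭ xs k ≢0))

  occursAt-insertAt : ∀ j k y ys → k ≤ length ys → occursAt j (insertAt k y ys) k ≡ δ y j
  occursAt-insertAt j zero    y ys       _         = refl
  occursAt-insertAt j (suc k) y (z ∷ ys) (s≤s k≤n) = occursAt-insertAt j k y ys k≤n

  pairCount-insertAt : ∀ i j k xs y ys → k < length xs → k ≤ length ys →
    pairCount i j xs (insertAt k y ys) ≡ occursAt i xs k * δ y j + pairCount i j (removeAt k xs) ys
  pairCount-insertAt i j zero    (x ∷ xs) y ys       _         _         = refl
  pairCount-insertAt i j (suc k) (x ∷ xs) y (z ∷ ys) (s≤s k<m) (s≤s k≤n) =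
    trans (cong (δ x i * δ z j +_) (pairCount-insertAt i j k xs y ys k<m k≤n))
          (x+[y+z]≡y+[x+z] (δ x i * δ z j) (occursAt i xs k * δ y j) _)

  matchingCount-insertAt : ∀ is js k xs y ys → k < length xs → k ≤ length ys → All (λ i → occursAt i xs k ≡ 0) is →
    matchingCount is js xs (insertAt k y ys) ≡ matchingCount is js (removeAt k xs) ys
  matchingCount-insertAt is js k xs y ys k<m k≤n absent = cong product (zipWith-cong-All
    (λ {i} {j} i-absent _ → trans (pairCount-insertAt i j k xs y ys k<m k≤n)
                                  (cong (λ c → c * δ y j + pairCount i j (removeAt k xs) ys) i-absent))
    absent (universal-U js))

  degreeProduct-↭ : ∀ is js {i j xs′ xs ys′ ys} → i ∷ xs′ ↭ xs → j ∷ ys′ ↭ ys →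
    All (i ≢_) is → All (j ≢_) js →
    degreeProduct is js xs′ ys′ ≡ degreeProduct is js xs ys
  degreeProduct-↭ is js p q i∉is j∉js = cong product (zipWith-cong-All
    (λ i≢i′ j≢j′ → cong₂ _*_ (multiplicity-↭-≢ p i≢i′) (multiplicity-↭-≢ q j≢j′)) i∉is j∉js)

  degreeProduct-regular : ∀ is js xs ys {d e} → (∀ i → multiplicity i xs ≡ d) → (∀ j → multiplicity j ys ≡ e) →
    length is ≡ length js → degreeProduct is js xs ys ≡ (d * e) ^ length is
  degreeProduct-regular []       js       xs ys _      _      _         = refl
  degreeProduct-regular (i ∷ is) (j ∷ js) xs ys xs-reg ys-reg |is|≡|js| =
    cong₂ _*_ (cong₂ _*_ (xs-reg i) (ys-reg j)) (degreeProduct-regular is js xs ys xs-reg ys-reg (suc-injective |is|≡|js|))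

  ∑-perms-fix-position : ∀ is js {i} j k xs y ys → length (y ∷ ys) ≡ length xs →
    occursAt i xs k ≢ 0 → All (i ≢_) is →
    ∑[ σ ← perms (y ∷ ys) ] (occursAt j σ k * matchingCount is js xs σ)
      ≡ ∑[ (y′ , ys′) ← selections (y ∷ ys) ]
          (δ y′ j * ∑[ τ ← perms ys′ ] matchingCount is js (removeAt k xs) τ)
  ∑-perms-fix-position is js {i} j k xs y ys |ys|≡|xs| i-at-k i∉is = begin
    ∑[ σ ← perms (y ∷ ys) ] (occursAt j σ k * M xs σ)
      ≡⟨ ∑-perms-insertAt k y ys _ ⟩
    ∑[ (y′ , ys′) ← selections (y ∷ ys) ] ∑[ τ ← perms ys′ ]
      (occursAt j (insertAt k y′ τ) k * M xs (insertAt k y′ τ))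
      ≡⟨ ∑-cong-All (All.map (λ {(y′ , ys′)} p →
           trans (∑-cong-All (All.map (λ {τ} q → summand (k≤length p q)) (perms-↭ ys′)))
                 (sym (*-distribˡ-∑ (δ y′ j) (perms ys′) (M (removeAt k xs)))))
         (selections-↭ (y ∷ ys))) ⟩
    ∑[ (y′ , ys′) ← selections (y ∷ ys) ] (δ y′ j * ∑[ τ ← perms ys′ ] M (removeAt k xs) τ) ∎
    where
    open ≡-Reasoning
    M = matchingCount is js
    k<|xs| : k < length xs
    k<|xs| = occursAt≢0⇒< xs k i-at-k
    k≤length : ∀ {y′ ys′ τ} → y′ ∷ ys′ ↭ y ∷ ys → τ ↭ ys′ → k ≤ length τ
    k≤length p q = s≤s⁻¹ (≤-trans k<|xs| (≤-reflexive
      (trans (sym |ys|≡|xs|) (trans (sym (↭-length p)) (cong suc (sym (↭-length q)))))))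
    absent : All (λ i′ → occursAt i′ xs k ≡ 0) is
    absent = All.map (λ i≢i′ → trans (occursAt≢0⇒δ xs k i-at-k _) (δ-≢ i≢i′)) i∉is
    summand : ∀ {y′ τ} → k ≤ length τ →
      occursAt j (insertAt k y′ τ) k * M xs (insertAt k y′ τ) ≡ δ y′ j * M (removeAt k xs) τ
    summand {y′} {τ} k≤|τ| =
      cong₂ _*_ (occursAt-insertAt j k y′ τ k≤|τ|) (matchingCount-insertAt is js k xs y′ τ k<|xs| k≤|τ| absent)

  ∑-perms-matchingCount : ∀ is js xs ys → Unique is → Unique js → length is ≡ length js → length ys ≡ length xs →
    ∑[ σ ← perms ys ] matchingCount is js xs σ ≡ degreeProduct is js xs ys * (length xs ∸ length is) !
  ∑-perms-matchingCount [] js xs ys _ _ _ |ys|≡|xs| =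
    trans (∑-const (perms ys) 1)
          (trans (*-identityʳ _) (trans (length-perms ys) (trans (cong _! |ys|≡|xs|) (sym (*-identityˡ _)))))
  ∑-perms-matchingCount (i ∷ is) (j ∷ js) []        []        _ _ _ _ = refl
  ∑-perms-matchingCount (i ∷ is) (j ∷ js) (x ∷ xs₀) (y ∷ ys₀)
                        (i∉is ∷ is-unique) (j∉js ∷ js-unique) |is|≡|js| |ys|≡|xs| = begin
    ∑[ σ ← perms ys ] (pairCount i j xs σ * M xs σ)
      ≡⟨ ∑-pairCount-*-positions i j xs (perms ys) (M xs) ⟩
    ∑[ k ← upTo N ] (occursAt i xs k * ∑[ σ ← perms ys ] (occursAt j σ k * M xs σ))
      ≡⟨ ∑-cong (upTo N) (λ k → *-congˡ-≢0 (occursAt i xs k) (fixedPosition k)) ⟩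
    ∑[ k ← upTo N ] (occursAt i xs k * (multiplicity j ys * R))
      ≡⟨ *-distribʳ-∑ (multiplicity j ys * R) (upTo N) (occursAt i xs) ⟨
    ∑[ k ← upTo N ] occursAt i xs k * (multiplicity j ys * R)
      ≡⟨ cong (_* (multiplicity j ys * R)) (multiplicity-positions i xs) ⟨
    multiplicity i xs * (multiplicity j ys * R)
      ≡⟨ *-assoc (multiplicity i xs) (multiplicity j ys) R ⟨
    multiplicity i xs * multiplicity j ys * R
      ≡⟨ *-assoc (multiplicity i xs * multiplicity j ys) (degreeProduct is js xs ys) _ ⟨
    degreeProduct (i ∷ is) (j ∷ js) xs ys * (N ∸ length (i ∷ is)) ! ∎
    where
    open ≡-Reasoning
    xs = x ∷ xs₀
    ys = y ∷ ys₀
    N = length xs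
    M = matchingCount is js
    R = degreeProduct is js xs ys * (N ∸ suc (length is)) !
    conditioned : ∀ {k y′ ys′} → occursAt i xs k ≢ 0 → y′ ≡ j → y′ ∷ ys′ ↭ ys →
      ∑[ τ ← perms ys′ ] M (removeAt k xs) τ ≡ R
    conditioned {k} {ys′ = ys′} i-at-k refl q = trans
      (∑-perms-matchingCount is js (removeAt k xs) ys′ is-unique js-unique (suc-injective |is|≡|js|)
        (suc-injective (trans (↭-length q) (trans |ys|≡|xs| (sym (↭-length p))))))
      (cong₂ _*_ (degreeProduct-↭ is js p q i∉is j∉js) (cong (λ l → (l ∸ suc (length is)) !) (↭-length p)))
      where
      p : i ∷ removeAt k xs ↭ xs
      p = occursAt≢0⇒↭ xs k i-at-k
    fixedPosition : ∀ k → occursAt i xs k ≢ 0 → ∑[ σ ← perms ys ] (occursAt j σ k * M xs σ) ≡ multiplicity j ys * R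
    fixedPosition k i-at-k = begin
      ∑[ σ ← perms ys ] (occursAt j σ k * M xs σ)
        ≡⟨ ∑-perms-fix-position is js j k xs y ys₀ |ys|≡|xs| i-at-k i∉is ⟩
      ∑[ (y′ , ys′) ← selections ys ] (δ y′ j * ∑[ τ ← perms ys′ ] M (removeAt k xs) τ)
        ≡⟨ ∑-cong-All (All.map (λ q → *-congˡ-≢0 _ (λ δ≢0 → conditioned {k} i-at-k (δ≢0⇒≡ δ≢0) q))
                               (selections-↭ ys)) ⟩
      ∑[ (y′ , _) ← selections ys ] (δ y′ j * R)
        ≡⟨ *-distribʳ-∑ R (selections ys) (λ (y′ , _) → δ y′ j) ⟨
      ∑[ (y′ , _) ← selections ys ] δ y′ j * R
        ≡⟨ cong (_* R) (∑-selections-head ys (λ y′ → δ y′ j)) ⟩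
      multiplicity j ys * R ∎

module FinCounting {n : ℕ} = Counting (_≟_ {n})
open FinCounting

multiplicity-allFin : ∀ n (i : Fin n) → multiplicity i (allFin n) ≡ 1
multiplicity-allFin (suc n) Fin.zero    = trans (∑-allFin-suc n (λ x → δ x Fin.zero)) (cong suc (∑-zero (allFin n)))
multiplicity-allFin (suc n) (Fin.suc i) = trans (∑-allFin-suc n (λ x → δ x (Fin.suc i))) (multiplicity-allFin n i)

multiplicity-halfEdges : ∀ n r (i : Fin n) → multiplicity i (map proj₁ (halfEdges n r)) ≡ r
multiplicity-halfEdges n r i = begin
  multiplicity i (map proj₁ (halfEdges n r))
    ≡⟨ ∑-map proj₁ (halfEdges n r) (λ x → δ x i) ⟩
  ∑[ h ← halfEdges n r ] δ (proj₁ h) i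
    ≡⟨ ∑-cartesianProduct (allFin n) (allFin r) (λ h → δ (proj₁ h) i) ⟩
  ∑[ x ← allFin n ] ∑[ _ ← allFin r ] δ x i
    ≡⟨ ∑-cong (allFin n) (λ x → ∑-const (allFin r) (δ x i)) ⟩
  ∑[ x ← allFin n ] (length (allFin r) * δ x i)
    ≡⟨ *-distribˡ-∑ (length (allFin r)) (allFin n) (λ x → δ x i) ⟨
  length (allFin r) * multiplicity i (allFin n)
    ≡⟨ cong₂ _*_ (length-tabulate {n = r} id) (multiplicity-allFin n i) ⟩
  r * 1
    ≡⟨ *-identityʳ r ⟩
  r ∎
  where open ≡-Reasoning

length-halfEdges : ∀ n r → length (map proj₁ (halfEdges n r)) ≡ r * n
length-halfEdges n r = begin
  length (map proj₁ (halfEdges n r))     ≡⟨ length-map proj₁ (halfEdges n r) ⟩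
  length (halfEdges n r)                 ≡⟨ length-cartesianProduct (allFin n) (allFin r) ⟩
  length (allFin n) * length (allFin r)  ≡⟨ cong₂ _*_ (length-tabulate {n = n} id) (length-tabulate {n = r} id) ⟩
  n * r                                  ≡⟨ *-comm n r ⟩
  r * n                                  ∎
  where open ≡-Reasoning

adjacency-pairCount : ∀ {n r} (σ : List (HalfEdge n r)) i j →
  adjacency σ i j ≡ pairCount i j (map proj₁ (halfEdges n r)) (map proj₁ σ)
adjacency-pairCount {n} {r} σ i j = begin
  length (filter (λ (h , s) → (proj₁ h ≟ i) ×-dec (proj₁ s ≟ j)) (zip H σ))
    ≡⟨ length-filter-∑ (λ (h , s) → (proj₁ h ≟ i) ×-dec (proj₁ s ≟ j)) (zip H σ) ⟩
  ∑[ (h , s) ← zip H σ ] 𝟙 (does (proj₁ h ≟ i) ∧ does (proj₁ s ≟ j))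
    ≡⟨ ∑-cong (zip H σ) (λ (h , s) → 𝟙-∧ (does (proj₁ h ≟ i)) (does (proj₁ s ≟ j))) ⟩
  ∑[ (h , s) ← zip H σ ] (δ (proj₁ h) i * δ (proj₁ s) j)
    ≡⟨ ∑-map (Product.map proj₁ proj₁) (zip H σ) (λ (x , y) → δ x i * δ y j) ⟨
  ∑[ (x , y) ← map (Product.map proj₁ proj₁) (zip H σ) ] (δ x i * δ y j)
    ≡⟨ cong (λ ps → ∑[ (x , y) ← ps ] (δ x i * δ y j)) (zip-map proj₁ proj₁ H σ) ⟨
  pairCount i j (map proj₁ H) (map proj₁ σ) ∎
  where
  open ≡-Reasoning
  H = halfEdges n r

length-elems : ∀ {n} (J : Subset n) → length (elems J) ≡ ∣ J ∣
length-elems {n} J = trans (length-filter-∑ (_∈? J) (allFin n)) (members J)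
  where
  members : ∀ {n} (J : Subset n) → ∑[ x ← allFin n ] 𝟙 (does (x ∈? J)) ≡ ∣ J ∣
  members         []            = refl
  members {suc n} (inside ∷ J)  = trans (∑-allFin-suc n (λ x → 𝟙 (does (x ∈? inside ∷ J)))) (cong suc (members J))
  members {suc n} (outside ∷ J) = trans (∑-allFin-suc n (λ x → 𝟙 (does (x ∈? outside ∷ J)))) (members J)

elems-unique : ∀ {n} (J : Subset n) → Unique (elems J)
elems-unique {n} J = Unique.filter⁺ (_∈? J) (Unique.allFin⁺ n)

length-subsetsOfSize : ∀ n m → length (subsetsOfSize n m) ≡ n C m
length-subsetsOfSize n m = trans (length-filter-∑ (λ I → ∣ I ∣ ℕ.≟ m) (allSubsets n)) (ofSize n m)
  where
  ofSize : ∀ n m → ∑[ I ← allSubsets n ] 𝟙 (does (∣ I ∣ ℕ.≟ m)) ≡ n C m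
  ofSize zero    zero    = refl
  ofSize zero    (suc m) = refl
  ofSize (suc n) m       = begin
    ∑ (map (inside ∷_) (allSubsets n) ++ map (outside ∷_) (allSubsets n)) (λ I → 𝟙 (does (∣ I ∣ ℕ.≟ m)))
      ≡⟨ ∑-++ (map (inside ∷_) (allSubsets n)) (map (outside ∷_) (allSubsets n)) _ ⟩
    ∑ (map (inside ∷_) (allSubsets n)) (λ I → 𝟙 (does (∣ I ∣ ℕ.≟ m)))
      + ∑ (map (outside ∷_) (allSubsets n)) (λ I → 𝟙 (does (∣ I ∣ ℕ.≟ m)))
      ≡⟨ cong₂ _+_ (∑-map (inside ∷_) (allSubsets n) _) (∑-map (outside ∷_) (allSubsets n) _) ⟩
    ∑[ I ← allSubsets n ] 𝟙 (does (suc ∣ I ∣ ℕ.≟ m)) + ∑[ I ← allSubsets n ] 𝟙 (does (∣ I ∣ ℕ.≟ m))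
      ≡⟨ pascal m ⟩
    suc n C m ∎
    where
    open ≡-Reasoning
    pascal : ∀ m →
      ∑[ I ← allSubsets n ] 𝟙 (does (suc ∣ I ∣ ℕ.≟ m)) + ∑[ I ← allSubsets n ] 𝟙 (does (∣ I ∣ ℕ.≟ m)) ≡ suc n C m
    pascal zero    = cong₂ _+_ (∑-zero (allSubsets n)) (ofSize n zero)
    pascal (suc m) = trans (cong₂ _+_ (ofSize n m) (ofSize n (suc m))) (nCk+nC[k+1]≡[n+1]C[k+1] n m)

∑-configurations-matchingCount : ∀ n r m (is js : List (Fin n)) → Unique is → Unique js →
  length is ≡ m → length js ≡ m →
  ∑[ σ ← configurations n r ] matchingCount is js (map proj₁ (halfEdges n r)) (map proj₁ σ) ≡ (r * r) ^ m * (r * n ∸ m) !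
∑-configurations-matchingCount n r m is js is-unique js-unique |is|≡m |js|≡m = begin
  ∑[ σ ← perms H ] matchingCount is js a (map proj₁ σ)
    ≡⟨ ∑-map (map proj₁) (perms H) (matchingCount is js a) ⟨
  ∑ (map (map proj₁) (perms H)) (matchingCount is js a)
    ≡⟨ cong (λ σs → ∑ σs (matchingCount is js a)) (perms-map proj₁ H) ⟨
  ∑ (perms a) (matchingCount is js a)
    ≡⟨ ∑-perms-matchingCount is js a a is-unique js-unique |is|≡|js| refl ⟩
  degreeProduct is js a a * (length a ∸ length is) !
    ≡⟨ cong₂ (λ d l → d * (l ∸ length is) !)
             (degreeProduct-regular is js a a (multiplicity-halfEdges n r) (multiplicity-halfEdges n r) |is|≡|js|)
             (length-halfEdges n r) ⟩
  (r * r) ^ length is * (r * n ∸ length is) !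
    ≡⟨ cong (λ l → (r * r) ^ l * (r * n ∸ l) !) |is|≡m ⟩
  (r * r) ^ m * (r * n ∸ m) ! ∎
  where
  open ≡-Reasoning
  H = halfEdges n r
  a = map proj₁ H
  |is|≡|js| = trans |is|≡m (sym |js|≡m)

∑-configurations-φ : ∀ n r m (J : Subset n) → ∣ J ∣ ≡ m →
  sum (map (λ σ → φ (adjacency σ) m J) (configurations n r)) ≡ (n C m) * r ^ (2 * m) * m ! * (r * n ∸ m) !
∑-configurations-φ n r m J |J|≡m = begin
  ∑[ σ ← configurations n r ] ∑[ I ← subsetsOfSize n m ] ∑[ cols ← perms (elems J) ]
    product (zipWith (adjacency σ) (elems I) cols)
    ≡⟨ ∑-cong (configurations n r) (λ σ → ∑-cong (subsetsOfSize n m) (λ I → ∑-cong (perms (elems J)) (λ cols →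
         cong product (zipWith-cong (adjacency-pairCount σ) (elems I) cols)))) ⟩
  ∑[ σ ← configurations n r ] ∑[ I ← subsetsOfSize n m ] ∑[ cols ← perms (elems J) ] M I σ cols
    ≡⟨ ∑-comm (configurations n r) (subsetsOfSize n m) (λ σ I → ∑[ cols ← perms (elems J) ] M I σ cols) ⟩
  ∑[ I ← subsetsOfSize n m ] ∑[ σ ← configurations n r ] ∑[ cols ← perms (elems J) ] M I σ cols
    ≡⟨ ∑-cong (subsetsOfSize n m) (λ I → ∑-comm (configurations n r) (perms (elems J)) (M I)) ⟩
  ∑[ I ← subsetsOfSize n m ] ∑[ cols ← perms (elems J) ] ∑[ σ ← configurations n r ] M I σ cols
    ≡⟨ ∑-cong-All (All.map (λ |I|≡m → ∑-cong-All (All.map (expected |I|≡m) (perms-↭ (elems J))))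
                           (all-filter (λ I → ∣ I ∣ ℕ.≟ m) (allSubsets n))) ⟩
  ∑[ I ← subsetsOfSize n m ] ∑[ cols ← perms (elems J) ] c
    ≡⟨ ∑-cong (subsetsOfSize n m) (λ _ → ∑-const (perms (elems J)) c) ⟩
  ∑[ I ← subsetsOfSize n m ] (length (perms (elems J)) * c)
    ≡⟨ ∑-const (subsetsOfSize n m) (length (perms (elems J)) * c) ⟩
  length (subsetsOfSize n m) * (length (perms (elems J)) * c)
    ≡⟨ cong₂ (λ s p → s * (p * c)) (length-subsetsOfSize n m) (trans (length-perms (elems J)) (cong _! |eJ|≡m)) ⟩
  (n C m) * (m ! * ((r * r) ^ m * (r * n ∸ m) !))
    ≡⟨ cong (λ p → (n C m) * (m ! * (p * (r * n ∸ m) !))) r*r^m ⟩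
  (n C m) * (m ! * (r ^ (2 * m) * (r * n ∸ m) !))
    ≡⟨ rearrange (n C m) (m !) (r ^ (2 * m)) ((r * n ∸ m) !) ⟩
  (n C m) * r ^ (2 * m) * m ! * (r * n ∸ m) ! ∎
  where
  open ≡-Reasoning
  M : Subset n → List (HalfEdge n r) → List (Fin n) → ℕ
  M I σ cols = matchingCount (elems I) cols (map proj₁ (halfEdges n r)) (map proj₁ σ)
  c = (r * r) ^ m * (r * n ∸ m) !
  |eJ|≡m : length (elems J) ≡ m
  |eJ|≡m = trans (length-elems J) |J|≡m
  expected : ∀ {I cols} → ∣ I ∣ ≡ m → cols ↭ elems J → ∑[ σ ← configurations n r ] M I σ cols ≡ c
  expected {I} {cols} |I|≡m cols↭J =
    ∑-configurations-matchingCount n r m (elems I) cols (elems-unique I) (Unique-resp-↭ (↭-sym cols↭J) (elems-unique J))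
      (trans (length-elems I) |I|≡m) (trans (↭-length cols↭J) |eJ|≡m)
  r*r^m : (r * r) ^ m ≡ r ^ (2 * m)
  r*r^m = trans (cong (λ s → (r * s) ^ m) (sym (*-identityʳ r))) (^-*-assoc r 2 m)
  rearrange : ∀ x y z w → x * (y * (z * w)) ≡ x * z * y * w
  rearrange = solve-∀

corollary4p2 : (n r m : ℕ) → n ≥ 1 → r ≥ 1 → m ≤ n →
    (J : Subset n) → ∣ J ∣ ≡ m →
    E-ν n r (λ A → φ A m J) ≡ rhs n r m
corollary4p2 n r m _ _ _ J |J|≡m =
  cong (λ s → (ℤ.+ s / ((r * n) !)) {{(r * n) !≢0}}) (∑-configurations-φ n r m J |J|≡m)
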